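{- The calculus $\mathbf{L}^{\Lambda}_{\backslash,/}\wedge\mathbf{0}\mathbf{1}$ is strongly complete with respect to the class of product-free non-standard square R-models: for every set $\mathcal{H}$ of product-free sequents and every product-free sequent $\Pi\to B$, if $\Pi\to B$ is true in every product-free non-standard square R-model in which all sequents of $\mathcal{H}$ are true, then $\Pi\to B$ is derivable from $\mathcal{H}$ in $\mathbf{L}^{\Lambda}_{\backslash,/}\wedge\mathbf{0}\mathbf{1}$.
   Context: Product-free formulae are built from a countable set of propositional variables and the constants $\mathbf{0}$ and $\mathbf{1}$ using the binary connectives $\backslash$, $/$, $\wedge$. A sequent is $\Pi \to B$ with $B$ a formula and $\Pi$ a finite, possibly empty, sequence of formulae (empty sequence written $\Lambda$). The calculus $\mathbf{L}^{\Lambda}_{\backslash,/}\wedge\mathbf{0}\mathbf{1}$ has axioms $A \to A$, $\Gamma,\mathbf{0},\Delta \to C$, $\Lambda \to \mathbf{1}$ and rules (capital Greek letters denote possibly empty sequences): (Cut) from $\Pi \to A$ and $\Gamma, A, \Delta \to C$ infer $\Gamma,\Pi,\Delta\to C$; ($\backslash L$) from $\Pi\to A$ and $\Gamma,B,\Delta\to C$ infer $\Gamma,\Pi,A\backslash B,\Delta\to C$; ($\backslash R$) from $A,\Pi\to B$ infer $\Pi\to A\backslash B$; ($/ L$) from $\Pi\to A$ and $\Gamma,B,\Delta\to C$ infer $\Gamma,B/A,\Pi,\Delta\to C$; ($/R$) from $\Pi,A\to B$ infer $\Pi\to B/A$; ($\wedge L$) from $\Gamma,A,\Delta\to C$ infer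 both $\Gamma,A\wedge B,\Delta\to C$ and $\Gamma,B\wedge A,\Delta\to C$; ($\wedge R$) from $\Pi\to A$ and $\Pi\to B$ infer $\Pi\to A\wedge B$; ($\mathbf{1} L$) from $\Gamma,\Delta\to C$ infer $\Gamma,\mathbf{1},\Delta\to C$. A sequent is derivable from a set of sequents $\mathcal H$ if it is derivable when the sequents of $\mathcal H$ are added as extra axioms. For binary relations $R,S$ on a non-empty set $W$: $R\circ S=\{(x,z) \mid \exists y\,((x,y)\in R, (y,z)\in S)\}$; $R\backslash S=\{(y,z)\in W\times W \mid \forall x\,((x,y)\in R\Rightarrow (x,z)\in S)\}$; $S/R=\{(x,y)\in W\times W \mid \forall z\,((y,z)\in R\Rightarrow(x,z)\in S)\}$; $\delta=\{(x,x)\mid x\in W\}$. A product-free non-standard square R-model is a tuple $(W,\mathfrak{A},\mathbf{1}_{\mathfrak{A}},\mathbf{0}_{\mathfrak{A}},v)$ where $W$ is non-empty; $\mathfrak{A}$ is a family of binary relations on $W$ closed under $\backslash,/,\cap$ (not necessarily under $\circ$); $\mathbf{1}_{\mathfrak{A}}\in\mathfrak{A}$ satisfies $\mathbf{1}_{\mathfrak{A}}\circ R=R\circ\mathbf{1}_{\mathfrak{A}}=R$ for all $R\in\mathfrak{A}$; $\mathbf{0}_{\mathfrak{A}}\in\mathfrak{A}$ satisfies $\mathbf{0}_{\mathfrak{A}}\subseteq R$ for all $R\in\mathfrak{A}$; and $v$ maps every product-free formula to a member of $\mathfrak{A}$ with $v(A\backslash B)=v(A)\backslash v(B)$, $v(B/A)=v(B)/v(A)$,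 $v(A\wedge B)=v(A)\cap v(B)$, $v(\mathbf{1})=\mathbf{1}_{\mathfrak{A}}$, $v(\mathbf{0})=\mathbf{0}_{\mathfrak{A}}$. A sequent $A_1,\ldots,A_n\to B$ ($n\ge1$) is true in the model if $v(A_1)\circ\cdots\circ v(A_n)\subseteq v(B)$, and $\Lambda\to B$ is true if $\delta\subseteq v(B)$. -}

module Defs where

open import Data.Nat using (ℕ)
open import Data.List using (List; []; _∷_; _++_)
open import Data.Product using (Σ; ∃; _×_; _,_)
open import Level using (Level; suc; _⊔_) renaming (zero to lzero)

infixr 6 _∖_
infixl 6 _⁄_
infixl 7 _∧_
data Fm : Set where
  var : ℕ → Fm
  𝟘 𝟙 : Fm
  _∖_ : Fm → Fm → Fm
  _⁄_ : Fm → Fm → Fm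
  _∧_ : Fm → Fm → Fm

infix 4 _⇒_
record Sequent : Set where
  constructor _⇒_
  field
    ant : List Fm
    concl : Fm

data _⊢_ (ℋ : Sequent → Set) : Sequent → Set where
  hyp  : ∀ {s} → ℋ s → ℋ ⊢ s
  ax   : ∀ {A} → ℋ ⊢ (A ∷ [] ⇒ A)
  ax0  : ∀ {Γ Δ C} → ℋ ⊢ (Γ ++ 𝟘 ∷ Δ ⇒ C)
  ax1  : ℋ ⊢ ([] ⇒ 𝟙)
  cut  : ∀ {Π A Γ Δ C} → ℋ ⊢ (Π ⇒ A) → ℋ ⊢ (Γ ++ A ∷ Δ ⇒ C) → ℋ ⊢ (Γ ++ Π ++ Δ ⇒ C)
  ∖L   : ∀ {Π A B Γ Δ C} → ℋ ⊢ (Π ⇒ A) → ℋ ⊢ (Γ ++ B ∷ Δ ⇒ C)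
         → ℋ ⊢ (Γ ++ Π ++ (A ∖ B) ∷ Δ ⇒ C)
  ∖R   : ∀ {Π A B} → ℋ ⊢ (A ∷ Π ⇒ B) → ℋ ⊢ (Π ⇒ A ∖ B)
  ⁄L   : ∀ {Π A B Γ Δ C} → ℋ ⊢ (Π ⇒ A) → ℋ ⊢ (Γ ++ B ∷ Δ ⇒ C)
         → ℋ ⊢ (Γ ++ (B ⁄ A) ∷ Π ++ Δ ⇒ C)
  ⁄R   : ∀ {Π A B} → ℋ ⊢ (Π ++ A ∷ [] ⇒ B) → ℋ ⊢ (Π ⇒ B ⁄ A)
  ∧L₁  : ∀ {Γ A B Δ C} → ℋ ⊢ (Γ ++ A ∷ Δ ⇒ C) → ℋ ⊢ (Γ ++ (A ∧ B) ∷ Δ ⇒ C)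
  ∧L₂  : ∀ {Γ A B Δ C} → ℋ ⊢ (Γ ++ A ∷ Δ ⇒ C) → ℋ ⊢ (Γ ++ (B ∧ A) ∷ Δ ⇒ C)
  ∧R   : ∀ {Π A B} → ℋ ⊢ (Π ⇒ A) → ℋ ⊢ (Π ⇒ B) → ℋ ⊢ (Π ⇒ A ∧ B)
  𝟙L   : ∀ {Γ Δ C} → ℋ ⊢ (Γ ++ Δ ⇒ C) → ℋ ⊢ (Γ ++ 𝟙 ∷ Δ ⇒ C)

-- Binary relations on W (as proof-relevant predicates, extensional comparison).
Rel : Set → Set₁
Rel W = W → W → Set

module _ {W : Set} where
  infix 4 _⊆ᵣ_ _≐_
  _⊆ᵣ_ : Rel W → Rel W → Set
  R ⊆ᵣ S = ∀ x y → R x y → S x y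

  _≐_ : Rel W → Rel W → Set
  R ≐ S = (R ⊆ᵣ S) × (S ⊆ᵣ R)

  _∘ᵣ_ : Rel W → Rel W → Rel W
  (R ∘ᵣ S) x z = Σ W λ y → R x y × S y z

  _∖ᵣ_ : Rel W → Rel W → Rel W
  (R ∖ᵣ S) y z = ∀ x → R x y → S x z

  _⁄ᵣ_ : Rel W → Rel W → Rel W
  (S ⁄ᵣ R) x y = ∀ z → R y z → S x z

  _∩ᵣ_ : Rel W → Rel W → Rel W
  (R ∩ᵣ S) x y = R x y × S x y

  δ : Rel W
  δ x y = x ≡′ y
    where
      open import Relation.Binary.PropositionalEquality using () renaming (_≡_ to _≡′_)

record RModel : Set₂ where
  field
    W    : Set
    w₀   : W
    𝔄    : Rel W → Set
    ∖-closed : ∀ {R S} → 𝔄 R → 𝔄 S → 𝔄 (R ∖ᵣ S)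
    ⁄-closed : ∀ {R S} → 𝔄 R → 𝔄 S → 𝔄 (S ⁄ᵣ R)
    ∩-closed : ∀ {R S} → 𝔄 R → 𝔄 S → 𝔄 (R ∩ᵣ S)
    one  : Rel W
    one∈ : 𝔄 one
    one-l : ∀ {R} → 𝔄 R → (one ∘ᵣ R) ≐ R
    one-r : ∀ {R} → 𝔄 R → (R ∘ᵣ one) ≐ R
    zero  : Rel W
    zero∈ : 𝔄 zero
    zero-least : ∀ {R} → 𝔄 R → zero ⊆ᵣ R
    v    : Fm → Rel W
    v∈   : ∀ A → 𝔄 (v A)
    v-∖  : ∀ A B → v (A ∖ B) ≐ (v A ∖ᵣ v B)
    v-⁄  : ∀ A B → v (B ⁄ A) ≐ (v B ⁄ᵣ v A)
    v-∧  : ∀ A B → v (A ∧ B) ≐ (v A ∩ᵣ v B)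
    v-𝟙  : v 𝟙 ≐ one
    v-𝟘  : v 𝟘 ≐ zero

  -- v(A₁) ∘ ⋯ ∘ v(Aₙ) for n ≥ 1
  comp : Fm → List Fm → Rel W
  comp A []       = v A
  comp A (A′ ∷ Π) = v A ∘ᵣ comp A′ Π

  TrueIn : Sequent → Set
  TrueIn ([]    ⇒ B) = δ ⊆ᵣ v B
  TrueIn (A ∷ Π ⇒ B) = comp A Π ⊆ᵣ v B

{-# OPTIONS --safe #-}
-- Canonical model.  Its worlds are words in a positive and a negative letter for each formula;
-- from any word one may push a positive letter, or pop a negative one, labelled by that formula,
-- so that negative letters act as inverses as in a free group (words are left unreduced).  A
-- formula A denotes the pairs of words joined by a path whose labels Γ satisfy ℋ ⊢ Γ ⇒ A.
-- Along a path positive letters are never removed and negative ones never created, so the labels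
-- of a path are determined by its end points; this gives ∧ and the step from truth to
-- derivability.  The inverses make ∖ and ⁄ complete: to show (⟦A⟧ ∖ ⟦B⟧) y z ⊆ ⟦A ∖ B⟧ y z one
-- starts from y extended by the inverse letter of A.  The resulting path either begins by
-- cancelling that letter or never reaches below it; the latter cannot happen both for A and for
-- the interderivable but distinct formula A ∧ A.
module Submission where

open import Defs
open import Data.List using (List; []; _∷_; _++_; _∷ʳ_; [_])
open import Data.List.Properties using (++-assoc; ++-identityʳ; ++-cancelʳ; ++-identityˡ-unique; ++-conicalʳ; ∷ʳ-injectiveʳ; ∷ʳ-++)
open import Data.Product using (_×_; _,_; proj₂; ∃-syntax)
open import Data.Sum using (_⊎_; inj₁; inj₂)
open import Data.Empty using (⊥-elim)
open import Relation.Nullary using (¬_)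
open import Relation.Binary.PropositionalEquality using (_≡_; _≢_; refl; sym; trans; cong; subst)

module _ {X : Set} where

  not-own-suffix : ∀ (P : List X) a w → w ≢ P ++ a ∷ w
  not-own-suffix P a w e with ++-conicalʳ P [ a ] (++-identityˡ-unique (P ∷ʳ a) (trans e (sym (∷ʳ-++ P a w))))
  ... | ()

  letter-before-suffix : ∀ (P Q : List X) {a b} w → P ++ a ∷ w ≡ Q ++ b ∷ w → a ≡ b
  letter-before-suffix P Q {a} {b} w e =
    ∷ʳ-injectiveʳ P Q (++-cancelʳ w (P ∷ʳ a) (Q ∷ʳ b) (trans (∷ʳ-++ P a w) (trans e (sym (∷ʳ-++ Q b w)))))

module _ {W : Set} where

  ⊆-trans : {R S T : Rel W} → R ⊆ᵣ S → S ⊆ᵣ T → R ⊆ᵣ T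
  ⊆-trans R⊆S S⊆T x y r = S⊆T x y (R⊆S x y r)

  ≐-refl : {R : Rel W} → R ≐ R
  ≐-refl = (λ _ _ r → r) , (λ _ _ r → r)

  ≐-sym : {R S : Rel W} → R ≐ S → S ≐ R
  ≐-sym (R⊆S , S⊆R) = S⊆R , R⊆S

  ≐-trans : {R S T : Rel W} → R ≐ S → S ≐ T → R ≐ T
  ≐-trans (R⊆S , S⊆R) (S⊆T , T⊆S) = ⊆-trans R⊆S S⊆T , ⊆-trans T⊆S S⊆R

  ∘-cong : {R R′ S S′ : Rel W} → R ≐ R′ → S ≐ S′ → (R ∘ᵣ S) ≐ (R′ ∘ᵣ S′)
  ∘-cong (R⊆ , ⊇R) (S⊆ , ⊇S) =
    (λ x z (y , r , s) → y , R⊆ x y r , S⊆ y z s) , (λ x z (y , r , s) → y , ⊇R x y r , ⊇S y z s)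

  ∖-cong : {R R′ S S′ : Rel W} → R ≐ R′ → S ≐ S′ → (R ∖ᵣ S) ≐ (R′ ∖ᵣ S′)
  ∖-cong (R⊆ , ⊇R) (S⊆ , ⊇S) =
    (λ y z h x r → S⊆ x z (h x (⊇R x y r))) , (λ y z h x r → ⊇S x z (h x (R⊆ x y r)))

  ⁄-cong : {R R′ S S′ : Rel W} → R ≐ R′ → S ≐ S′ → (S ⁄ᵣ R) ≐ (S′ ⁄ᵣ R′)
  ⁄-cong (R⊆ , ⊇R) (S⊆ , ⊇S) =
    (λ x y h z r → S⊆ x z (h z (⊇R y z r))) , (λ x y h z r → ⊇S x z (h z (R⊆ y z r)))

  ∩-cong : {R R′ S S′ : Rel W} → R ≐ R′ → S ≐ S′ → (R ∩ᵣ S) ≐ (R′ ∩ᵣ S′)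
  ∩-cong (R⊆ , ⊇R) (S⊆ , ⊇S) =
    (λ x y (r , s) → R⊆ x y r , S⊆ x y s) , (λ x y (r , s) → ⊇R x y r , ⊇S x y s)

module Walks (X : Set) where

  data Letter : Set where
    pos neg : X → Letter

  neg-injective : ∀ {a b} → neg a ≡ neg b → a ≡ b
  neg-injective refl = refl

  pos-injective : ∀ {a b} → pos a ≡ pos b → a ≡ b
  pos-injective refl = refl

  Word : Set
  Word = List Letter

  infix 4 _─[_]→_ _─[_]→*_
  data _─[_]→_ : Word → X → Word → Set where
    push : ∀ {w a} → w ─[ a ]→ pos a ∷ w
    pop  : ∀ {w a} → neg a ∷ w ─[ a ]→ w

  infixr 5 _◅_ _◅◅_
  data _─[_]→*_ : Word → List X → Word → Set where
    ε   : ∀ {w} → w ─[ [] ]→* w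
    _◅_ : ∀ {u v w a as} → u ─[ a ]→ v → v ─[ as ]→* w → u ─[ a ∷ as ]→* w

  variable
    a b : X
    as bs : List X
    u v w t : Word

  _◅◅_ : u ─[ as ]→* v → v ─[ bs ]→* w → u ─[ as ++ bs ]→* w
  ε       ◅◅ q = q
  (s ◅ p) ◅◅ q = s ◅ (p ◅◅ q)

  walk : ∀ as → ∃[ w ] u ─[ as ]→* w
  walk []       = _ , ε
  walk (a ∷ as) = let w , p = walk as in w , push ◅ p

  pos-persists : pos a ∷ u ─[ as ]→* w → ∃[ P ] w ≡ P ++ pos a ∷ u
  pos-persists ε = [] , refl
  pos-persists (push ◅ p) with pos-persists p
  ... | P , refl = P ∷ʳ pos _ , sym (∷ʳ-++ P _ _)

  neg-inherited : ∀ P → u ─[ as ]→* w → w ≡ P ++ neg a ∷ t → ∃[ Q ] u ≡ Q ++ neg a ∷ t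
  neg-inherited P ε e = P , e
  neg-inherited P (push ◅ p) e with neg-inherited P p e
  ... | [] , ()
  ... | _ ∷ Q , refl = Q , refl
  neg-inherited P (pop ◅ p) e with neg-inherited P p e
  ... | Q , refl = neg _ ∷ Q , refl

  no-cycle : u ─[ a ]→ v → ¬ (v ─[ as ]→* u)
  no-cycle push p = let P , e = pos-persists p in not-own-suffix P _ _ e
  no-cycle pop  p = let Q , e = neg-inherited [] p refl in not-own-suffix Q _ _ e

  push-pop-apart : pos b ∷ neg a ∷ v ─[ as ]→* w → ¬ (v ─[ bs ]→* w)
  push-pop-apart p q =
    let P , e  = pos-persists p
        Q , e′ = neg-inherited (P ∷ʳ pos _) q (trans e (sym (∷ʳ-++ P _ _)))
    in not-own-suffix Q _ _ e′

  labels-unique : u ─[ as ]→* w → u ─[ bs ]→* w → as ≡ bs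
  labels-unique ε       ε       = refl
  labels-unique ε       (s ◅ q) = ⊥-elim (no-cycle s q)
  labels-unique (s ◅ p) ε       = ⊥-elim (no-cycle s p)
  labels-unique (pop ◅ p)  (pop ◅ q)  = cong (_ ∷_) (labels-unique p q)
  labels-unique (push ◅ p) (pop ◅ q)  = ⊥-elim (push-pop-apart p q)
  labels-unique (pop ◅ p)  (push ◅ q) = ⊥-elim (push-pop-apart q p)
  labels-unique (push ◅ p) (push ◅ q) with pos-persists p | pos-persists q
  ... | P , e | Q , e′ with pos-injective (letter-before-suffix P Q _ (trans (sym e) e′))
  ...   | refl = cong (_ ∷_) (labels-unique p q)

  leave-neg : neg a ∷ v ─[ as ]→* w → (∃[ bs ] as ≡ a ∷ bs × v ─[ bs ]→* w) ⊎ (∃[ P ] w ≡ P ++ neg a ∷ v)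
  leave-neg ε          = inj₂ ([] , refl)
  leave-neg (pop ◅ p)  = inj₁ (_ , refl , p)
  leave-neg (push ◅ p) = let P , e = pos-persists p in inj₂ (P ∷ʳ pos _ , trans e (sym (∷ʳ-++ P _ _)))

  enter-pos : u ─[ as ]→* pos a ∷ v → (∃[ bs ] as ≡ bs ∷ʳ a × u ─[ bs ]→* v) ⊎ (∃[ P ] u ≡ P ++ pos a ∷ v)
  enter-pos ε = inj₂ ([] , refl)
  enter-pos (pop ◅ p) with enter-pos p
  ... | inj₁ (bs , refl , q) = inj₁ (_ ∷ bs , refl , pop ◅ q)
  ... | inj₂ (P , e)         = inj₂ (neg _ ∷ P , cong (neg _ ∷_) e)
  enter-pos (push ◅ p) with enter-pos p
  ... | inj₁ (bs , refl , q)    = inj₁ (_ ∷ bs , refl , push ◅ q)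
  ... | inj₂ (_ ∷ P , refl)     = inj₂ (P , refl)
  ... | inj₂ ([] , refl) with labels-unique p ε
  ...   | refl = inj₁ ([] , refl , ε)

variable
  ℋ : Sequent → Set
  A B C D : Fm
  Γ Δ : List Fm

cast : Γ ≡ Δ → ℋ ⊢ (Γ ⇒ C) → ℋ ⊢ (Δ ⇒ C)
cast {ℋ = ℋ} {C = C} = subst (λ Π → ℋ ⊢ (Π ⇒ C))

cut₁ : ℋ ⊢ (Γ ⇒ A) → ℋ ⊢ (A ∷ [] ⇒ C) → ℋ ⊢ (Γ ⇒ C)
cut₁ {Γ = Γ} d e = cast (++-identityʳ Γ) (cut {Γ = []} {Δ = []} d e)

∖-elim : ℋ ⊢ (Γ ⇒ A) → ℋ ⊢ (Δ ⇒ A ∖ B) → ℋ ⊢ (Γ ++ Δ ⇒ B)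
∖-elim {Γ = Γ} {Δ = Δ} d e =
  cast (cong (Γ ++_) (++-identityʳ Δ)) (cut {Γ = Γ} {Δ = []} e (∖L {Γ = []} {Δ = []} d ax))

⁄-elim : ℋ ⊢ (Γ ⇒ B ⁄ A) → ℋ ⊢ (Δ ⇒ A) → ℋ ⊢ (Γ ++ Δ ⇒ B)
⁄-elim {Γ = Γ} {Δ = Δ} e d =
  cast (cong (Γ ++_) (++-identityʳ Δ)) (cut {Γ = []} {Δ = Δ ++ []} e (⁄L {Γ = []} {Δ = []} d ax))

𝟙-elimˡ : ℋ ⊢ (Γ ⇒ 𝟙) → ℋ ⊢ (Δ ⇒ A) → ℋ ⊢ (Γ ++ Δ ⇒ A)
𝟙-elimˡ d e = cut {Γ = []} d (𝟙L {Γ = []} e)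

𝟙-elimʳ : ℋ ⊢ (Γ ⇒ A) → ℋ ⊢ (Δ ⇒ 𝟙) → ℋ ⊢ (Γ ++ Δ ⇒ A)
𝟙-elimʳ {Γ = Γ} {Δ = Δ} d e =
  cast (cong (Γ ++_) (++-identityʳ Δ))
       (cut {Γ = Γ} {Δ = []} e (𝟙L {Γ = Γ} {Δ = []} (cast (sym (++-identityʳ Γ)) d)))

A≢A∧B : A ≢ A ∧ B
A≢A∧B {var _} ()
A≢A∧B {𝟘} ()
A≢A∧B {𝟙} ()
A≢A∧B {_ ∖ _} ()
A≢A∧B {_ ⁄ _} ()
A≢A∧B {A ∧ C} e = A≢A∧B {A} {C} (cong left e)
  where
    left : Fm → Fm
    left (X ∧ _) = X
    left X       = X

module Canonical (ℋ : Sequent → Set) where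
  open Walks Fm

  ⟦_⟧ : Fm → Rel Word
  ⟦ A ⟧ u w = ∃[ Γ ] u ─[ Γ ]→* w × ℋ ⊢ (Γ ⇒ A)

  ⟦⟧-compose : (∀ {Γ Δ} → ℋ ⊢ (Γ ⇒ A) → ℋ ⊢ (Δ ⇒ B) → ℋ ⊢ (Γ ++ Δ ⇒ C)) → (⟦ A ⟧ ∘ᵣ ⟦ B ⟧) ⊆ᵣ ⟦ C ⟧
  ⟦⟧-compose rule _ _ (_ , (Γ , p , d) , (Δ , q , e)) = Γ ++ Δ , p ◅◅ q , rule d e

  two-variants : {R : Set} (ℓ : Fm → Letter) → (∀ {D D′} → ℓ D ≡ ℓ D′ → D ≡ D′) →
    (∀ {D} → ℋ ⊢ (D ∷ [] ⇒ A) → ℋ ⊢ (A ∷ [] ⇒ D) → R ⊎ ∃[ P ] t ≡ P ++ ℓ D ∷ u) → R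
  two-variants ℓ ℓ-injective attempt with attempt ax ax | attempt (∧L₁ {Γ = []} {Δ = []} ax) (∧R ax ax)
  ... | inj₁ r | _      = r
  ... | inj₂ _ | inj₁ r = r
  ... | inj₂ (P , e) | inj₂ (Q , e′) = ⊥-elim (A≢A∧B (ℓ-injective (letter-before-suffix P Q _ (trans (sym e) e′))))

  ∖-sound : ⟦ A ∖ B ⟧ ⊆ᵣ (⟦ A ⟧ ∖ᵣ ⟦ B ⟧)
  ∖-sound y z r x l = ⟦⟧-compose ∖-elim x z (y , l , r)

  ∖-complete-via : ℋ ⊢ (D ∷ [] ⇒ A) → ℋ ⊢ (A ∷ [] ⇒ D) → (⟦ A ⟧ ∖ᵣ ⟦ B ⟧) v w →
    ⟦ A ∖ B ⟧ v w ⊎ ∃[ P ] w ≡ P ++ neg D ∷ v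
  ∖-complete-via D⇒A A⇒D h with h (neg _ ∷ _) (_ ∷ [] , pop ◅ ε , D⇒A)
  ... | Γ , p , d with leave-neg p
  ...   | inj₁ (Γ′ , refl , q) = inj₁ (Γ′ , q , ∖R (cut {Γ = []} A⇒D d))
  ...   | inj₂ below = inj₂ below

  ∖-complete : (⟦ A ⟧ ∖ᵣ ⟦ B ⟧) ⊆ᵣ ⟦ A ∖ B ⟧
  ∖-complete _ _ h = two-variants neg neg-injective (λ D⇒A A⇒D → ∖-complete-via D⇒A A⇒D h)

  ⁄-sound : ⟦ B ⁄ A ⟧ ⊆ᵣ (⟦ B ⟧ ⁄ᵣ ⟦ A ⟧)
  ⁄-sound x y r z l = ⟦⟧-compose ⁄-elim x z (y , r , l)

  ⁄-complete-via : ℋ ⊢ (D ∷ [] ⇒ A) → ℋ ⊢ (A ∷ [] ⇒ D) → (⟦ B ⟧ ⁄ᵣ ⟦ A ⟧) u v →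
    ⟦ B ⁄ A ⟧ u v ⊎ ∃[ P ] u ≡ P ++ pos D ∷ v
  ⁄-complete-via D⇒A A⇒D h with h (pos _ ∷ _) (_ ∷ [] , push ◅ ε , D⇒A)
  ... | Γ , p , d with enter-pos p
  ...   | inj₁ (Γ′ , refl , q) = inj₁ (Γ′ , q , ⁄R (cut {Γ = Γ′} {Δ = []} A⇒D d))
  ...   | inj₂ above = inj₂ above

  ⁄-complete : (⟦ B ⟧ ⁄ᵣ ⟦ A ⟧) ⊆ᵣ ⟦ B ⁄ A ⟧
  ⁄-complete _ _ h = two-variants pos pos-injective (λ D⇒A A⇒D → ⁄-complete-via D⇒A A⇒D h)

  ∧-sound : ⟦ A ∧ B ⟧ ⊆ᵣ (⟦ A ⟧ ∩ᵣ ⟦ B ⟧)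
  ∧-sound _ _ (Γ , p , d) =
    (Γ , p , cut₁ d (∧L₁ {Γ = []} {Δ = []} ax)) , (Γ , p , cut₁ d (∧L₂ {Γ = []} {Δ = []} ax))

  ∧-complete : (⟦ A ⟧ ∩ᵣ ⟦ B ⟧) ⊆ᵣ ⟦ A ∧ B ⟧
  ∧-complete _ _ ((Γ , p , d) , (Δ , q , e)) with labels-unique p q
  ... | refl = Γ , p , ∧R d e

  𝟙-unitˡ : (⟦ 𝟙 ⟧ ∘ᵣ ⟦ A ⟧) ≐ ⟦ A ⟧
  𝟙-unitˡ = ⟦⟧-compose 𝟙-elimˡ , λ u _ r → u , ([] , ε , ax1) , r

  𝟙-unitʳ : (⟦ A ⟧ ∘ᵣ ⟦ 𝟙 ⟧) ≐ ⟦ A ⟧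
  𝟙-unitʳ = ⟦⟧-compose 𝟙-elimʳ , λ _ w r → w , r , ([] , ε , ax1)

  𝟘-least : ⟦ 𝟘 ⟧ ⊆ᵣ ⟦ A ⟧
  𝟘-least _ _ (Γ , p , d) = Γ , p , cut₁ d (ax0 {Γ = []} {Δ = []})

  Definable : Rel Word → Set
  Definable R = ∃[ A ] R ≐ ⟦ A ⟧

  model : RModel
  model = record
    { W = Word
    ; w₀ = []
    ; 𝔄 = Definable
    ; ∖-closed = λ { (A , R≐A) (B , S≐B) → A ∖ B , ≐-trans (∖-cong R≐A S≐B) (∖-complete , ∖-sound) }
    ; ⁄-closed = λ { (A , R≐A) (B , S≐B) → B ⁄ A , ≐-trans (⁄-cong R≐A S≐B) (⁄-complete , ⁄-sound) }
    ; ∩-closed = λ { (A , R≐A) (B , S≐B) → A ∧ B , ≐-trans (∩-cong R≐A S≐B) (∧-complete , ∧-sound) }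
    ; one = ⟦ 𝟙 ⟧
    ; one∈ = 𝟙 , ≐-refl
    ; one-l = λ { (A , R≐A) → ≐-trans (∘-cong ≐-refl R≐A) (≐-trans 𝟙-unitˡ (≐-sym R≐A)) }
    ; one-r = λ { (A , R≐A) → ≐-trans (∘-cong R≐A ≐-refl) (≐-trans 𝟙-unitʳ (≐-sym R≐A)) }
    ; zero = ⟦ 𝟘 ⟧
    ; zero∈ = 𝟘 , ≐-refl
    ; zero-least = λ { (A , R≐A) → ⊆-trans 𝟘-least (proj₂ R≐A) }
    ; v = ⟦_⟧
    ; v∈ = λ A → A , ≐-refl
    ; v-∖ = λ _ _ → ∖-sound , ∖-complete
    ; v-⁄ = λ _ _ → ⁄-sound , ⁄-complete
    ; v-∧ = λ _ _ → ∧-sound , ∧-complete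
    ; v-𝟙 = ≐-refl
    ; v-𝟘 = ≐-refl
    }

  open RModel model using (comp; TrueIn)

  cut-along : ∀ Θ {A Π C u w} → comp A Π u w → ℋ ⊢ (Θ ++ A ∷ Π ⇒ C) → ∃[ Γ ] u ─[ Γ ]→* w × ℋ ⊢ (Θ ++ Γ ⇒ C)
  cut-along Θ {Π = []} (Γ , p , d) e = Γ , p , cast (cong (Θ ++_) (++-identityʳ Γ)) (cut {Γ = Θ} {Δ = []} d e)
  cut-along Θ {Π = A′ ∷ Π} (_ , (Γ , p , d) , r) e
    with cut-along (Θ ++ Γ) r (cast (sym (++-assoc Θ Γ (A′ ∷ Π))) (cut {Γ = Θ} d e))
  ... | Γ′ , q , d′ = Γ ++ Γ′ , p ◅◅ q , cast (++-assoc Θ Γ Γ′) d′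

  hypotheses-true : ∀ s → ℋ s → TrueIn s
  hypotheses-true ([] ⇒ B) h _ _ refl = [] , ε , hyp h
  hypotheses-true (A ∷ Π ⇒ B) h u w r = cut-along [] r (hyp h)

  path⇒comp : ∀ {A Π u w} → u ─[ A ∷ Π ]→* w → comp A Π u w
  path⇒comp {Π = []} p = _ , p , ax
  path⇒comp {Π = _ ∷ _} (s ◅ p) = _ , (_ , s ◅ ε , ax) , path⇒comp p

  true-along : ∀ {Π B u w} → TrueIn (Π ⇒ B) → u ─[ Π ]→* w → ⟦ B ⟧ u w
  true-along {[]} t ε = t _ _ refl
  true-along {_ ∷ _} t p = t _ _ (path⇒comp p)

  true⇒derivable : ∀ s → TrueIn s → ℋ ⊢ s
  true⇒derivable (Π ⇒ B) t with walk {u = []} Π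
  ... | _ , p with true-along t p
  ...   | Γ , q , d = cast (labels-unique q p) d

theorem7p4 : (ℋ : Sequent → Set) (s : Sequent)
    → ((M : RModel) → (∀ h → ℋ h → RModel.TrueIn M h) → RModel.TrueIn M s)
    → ℋ ⊢ s
theorem7p4 ℋ s valid = true⇒derivable s (valid model hypotheses-true)
  where open Canonical ℋ
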